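{- Let $f=f(x_1,\ldots,x_n)$ be a positive threshold non-split Boolean function. If there exists $i\in[n]$ such that both $f_0=f_{|x_i=0}$ and $f_1=f_{|x_i=1}$ are split, then there exists $s\in[n]\setminus\{i\}$ such that $(f_0)_{|x_s=0}\equiv 0$ and $(f_1)_{|x_s=1}\equiv 1$.
   Context: $B=\{0,1\}$; for $x,y\in B^n$, $x\preceq y$ means $(x)_i=1$ implies $(y)_i=1$. $f$ is positive if $f(x)=1$ and $x\preceq y$ imply $f(y)=1$; threshold if there are reals $w_1,\dots,w_n,t$ with $f(x)=0\iff\sum_iw_ix_i\le t$. For a variable $x_j$ and $\alpha\in B$, $g_{|x_j=\alpha}$ denotes the function of the remaining variables obtained from $g$ by fixing $x_j=\alpha$ (the functions $f_0,f_1$ are regarded as functions of the variables $x_j$, $j\ne i$). A Boolean function $g$ is split if it has a variable $x_j$ with $g_{|x_j=0}\equiv 0$ or $g_{|x_j=1}\equiv 1$; otherwise it is non-split.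
   Formalization: The weights $w_1,\dots,w_n$ and the threshold $t$ defining a threshold function are rational rather than real. -}

module Defs where

open import Data.Nat using (ℕ; zero; suc)
open import Data.Fin using (Fin)
open import Data.Bool using (Bool; true; false; if_then_else_)
open import Data.Rational using (ℚ; 0ℚ; _+_; _≤_)
open import Data.Vec.Functional using (Vector; insertAt)
open import Data.Product using (Σ; ∃; _×_)
open import Data.Sum using (_⊎_)
open import Data.Empty using (⊥)
open import Relation.Binary.PropositionalEquality using (_≡_)
open import Function.Bundles using (_⇔_)

BoolFun : ℕ → Set
BoolFun n = (Fin n → Bool) → Bool

_≼_ : ∀ {n} → (Fin n → Bool) → (Fin n → Bool) → Set
x ≼ y = ∀ i → x i ≡ true → y i ≡ true

Positive : ∀ {n} → BoolFun n → Set
Positive {n} f = ∀ (x y : Fin n → Bool) → f x ≡ true → x ≼ y → f y ≡ true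

weightedSum : ∀ {n} → (Fin n → ℚ) → (Fin n → Bool) → ℚ
weightedSum {zero}  w x = 0ℚ
weightedSum {suc n} w x =
  (if x Fin.zero then w Fin.zero else 0ℚ) + weightedSum (λ j → w (Fin.suc j)) (λ j → x (Fin.suc j))

Threshold : ∀ {n} → BoolFun n → Set
Threshold {n} f = Σ (Fin n → ℚ) λ w → Σ ℚ λ t →
  ∀ (x : Fin n → Bool) → (f x ≡ false) ⇔ (weightedSum w x ≤ t)

restrict : ∀ {n} → Fin (suc n) → Bool → BoolFun (suc n) → BoolFun n
restrict j α g = λ x → g (insertAt x j α)

IsZero : ∀ {n} → BoolFun n → Set
IsZero g = ∀ x → g x ≡ false

IsOne : ∀ {n} → BoolFun n → Set
IsOne g = ∀ x → g x ≡ true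

Split : ∀ {n} → BoolFun n → Set
Split {zero}  g = ⊥
Split {suc n} g = ∃ λ (j : Fin (suc n)) →
  IsZero (restrict j false g) ⊎ IsOne (restrict j true g)

NonSplit : ∀ {n} → BoolFun n → Set
NonSplit g = Split g → ⊥

-- conclusion: some variable x_s of f₀, f₁ (i.e. s ∈ [n] ∖ {i}) with
-- (f₀)_{|x_s=0} ≡ 0 and (f₁)_{|x_s=1} ≡ 1
CommonSplitVar : ∀ {m} → BoolFun m → BoolFun m → Set
CommonSplitVar {zero}  f₀ f₁ = ⊥
CommonSplitVar {suc m} f₀ f₁ = ∃ λ (s : Fin (suc m)) →
  IsZero (restrict s false f₀) × IsOne (restrict s true f₁)

{-# OPTIONS --safe #-}
module Submission where

-- Since f is positive and non-split, f₀ can only split through some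
-- (f₀)|x_j=0 ≡ 0 and f₁ only through some (f₁)|x_k=1 ≡ 1: the other kinds of split
-- would propagate to f by monotonicity. If (f₀)|x_k=0 ≡ 0 as well, s = k works.
-- Otherwise there is p with p_i = p_k = 0 and f(p) = 1, and we take s = j: a point q
-- with q_i = q_j = 1 and f(q) = 0 would give, after moving x_j to 0 and x_k to 1 in
-- both p and q, two true and two false points with the same coordinatewise sums,
-- which no threshold function admits.

open import Defs
open import Data.Nat using (ℕ; suc; zero)
open import Data.Fin using (Fin; zero; suc; punchIn; _≟_)
open import Data.Fin.Properties using (punchInᵢ≢i)
open import Data.Fin.Subset.Properties using (anySubset?)
open import Data.Bool using (Bool; true; false; if_then_else_)
import Data.Bool as Bool
open import Data.Bool.Properties using (¬-not; not-¬)
open import Data.Vec using (lookup; tabulate)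
open import Data.Vec.Properties using (lookup∘tabulate)
open import Data.Vec.Functional using (Vector; insertAt; removeAt; updateAt)
open import Data.Vec.Functional.Properties
  using (insertAt-lookup; insertAt-punchIn; insertAt-removeAt; updateAt-updates; updateAt-minimal)
open import Data.Rational using (ℚ; 0ℚ; _+_; _≤_; _<_)
open import Data.Rational.Properties
  using (+-comm; +-0-commutativeMonoid; <-irrefl; ≤-<-trans; ≰⇒>; +-mono-≤; +-mono-<)
open import Algebra.Bundles using (CommutativeMonoid)
open import Algebra.Properties.CommutativeSemigroup
  (CommutativeMonoid.commutativeSemigroup +-0-commutativeMonoid) using (interchange)
open import Data.Product using (∃; _×_; _,_)
open import Data.Sum using (_⊎_; inj₁; inj₂)
open import Data.Empty using (⊥-elim)
open import Relation.Nullary using (¬_; yes; no; contradiction)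
open import Relation.Binary.PropositionalEquality
  using (_≡_; _≢_; _≗_; refl; sym; trans; cong₂; ≢-sym; module ≡-Reasoning)
open import Function using (const; _∘_)
open import Function.Bundles using (Equivalence)

private
  variable
    A : Set
    n : ℕ

-- Without function extensionality a Boolean function need not respect ≗ on its inputs.
Extensional : BoolFun n → Set
Extensional g = ∀ {x y} → x ≗ y → g x ≡ g y

≗⇒≼ : {x y : Fin n → Bool} → x ≗ y → x ≼ y
≗⇒≼ x≗y l xl = trans (sym (x≗y l)) xl

positive-false : {f : BoolFun n} → Positive f → ∀ {x y} → x ≼ y → f y ≡ false → f x ≡ false
positive-false pos x≼y fy = ¬-not λ fx → not-¬ (pos _ _ fx x≼y) fy

positive⇒extensional : {f : BoolFun n} → Positive f → Extensional f
positive⇒extensional {f = f} pos {x} {y} x≗y with f y in fy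
... | true  = pos y x fy (≗⇒≼ (sym ∘ x≗y))
... | false = positive-false pos (≗⇒≼ x≗y) fy

insertAt-cong : ∀ {x y : Vector A n} i a → x ≗ y → insertAt x i a ≗ insertAt y i a
insertAt-cong             zero    a x≗y zero    = refl
insertAt-cong             zero    a x≗y (suc l) = x≗y l
insertAt-cong {n = suc n} (suc i) a x≗y zero    = x≗y zero
insertAt-cong {n = suc n} (suc i) a x≗y (suc l) = insertAt-cong i a (x≗y ∘ suc) l

restrict-extensional : {g : BoolFun (suc n)} → Extensional g → ∀ j a → Extensional (restrict j a g)
restrict-extensional ext j a x≗y = ext (insertAt-cong j a x≗y)

restrict-removeAt : {g : BoolFun (suc n)} → Extensional g →
  ∀ {z j a} → z j ≡ a → restrict j a g (removeAt z j) ≡ g z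
restrict-removeAt ext {z} {j} refl = ext (insertAt-removeAt z j)

isZero⊎true : {g : BoolFun n} → Extensional g → IsZero g ⊎ ∃ λ x → g x ≡ true
isZero⊎true {g = g} ext with anySubset? (λ v → g (lookup v) Bool.≟ true)
... | yes (v , gv) = inj₂ (lookup v , gv)
... | no ∄ = inj₁ λ x →
  trans (ext (sym ∘ lookup∘tabulate x)) (¬-not λ gx → ∄ (tabulate x , gx))

face⇒restrict : {g : BoolFun (suc n)} → ∀ j {a c} →
  (∀ z → z j ≡ a → g z ≡ c) → ∀ y → restrict j a g y ≡ c
face⇒restrict j h y = h _ (insertAt-lookup y j _)

insertAt²-punchIn : ∀ (y : Vector A n) i j {a b} → insertAt (insertAt y j b) i a (punchIn i j) ≡ b
insertAt²-punchIn y i j = trans (insertAt-punchIn _ i _ j) (insertAt-lookup y j _)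

module _ {f : BoolFun (suc (suc n))} (i : Fin (suc (suc n))) (j : Fin (suc n)) {a b c : Bool} where

  face⇒restrict² : (∀ z → z i ≡ a → z (punchIn i j) ≡ b → f z ≡ c) →
    ∀ y → restrict j b (restrict i a f) y ≡ c
  face⇒restrict² h y = h _ (insertAt-lookup _ i a) (insertAt²-punchIn y i j)

  restrict²⇒face : Extensional f → (∀ y → restrict j b (restrict i a f) y ≡ c) →
    ∀ z → z i ≡ a → z (punchIn i j) ≡ b → f z ≡ c
  restrict²⇒face ext h z zi zJ =
    trans (sym (restrict-removeAt ext zi))
      (trans (sym (restrict-removeAt (restrict-extensional ext i a) zJ)) (h _))

lowered-≼ : ∀ (z : Fin n → Bool) i → updateAt z i (const false) ≼ z
lowered-≼ z i l zl with l ≟ i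
... | yes refl = contradiction (trans (sym (updateAt-updates i z)) zl) λ ()
... | no l≢i   = trans (sym (updateAt-minimal l i z l≢i)) zl

raised-≽ : ∀ (z : Fin n → Bool) i → z ≼ updateAt z i (const true)
raised-≽ z i l zl with l ≟ i
... | yes refl = updateAt-updates i z
... | no l≢i   = trans (updateAt-minimal l i z l≢i) zl

module _ {f : BoolFun n} (pos : Positive f) {i J : Fin n} (J≢i : J ≢ i) {b : Bool} where

  one-face-widen : (∀ z → z i ≡ false → z J ≡ b → f z ≡ true) → ∀ z → z J ≡ b → f z ≡ true
  one-face-widen h z zJ = pos _ z
    (h _ (updateAt-updates i z) (trans (updateAt-minimal J i z J≢i) zJ)) (lowered-≼ z i)

  zero-face-widen : (∀ z → z i ≡ true → z J ≡ b → f z ≡ false) → ∀ z → z J ≡ b → f z ≡ false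
  zero-face-widen h z zJ = positive-false pos (raised-≽ z i)
    (h _ (updateAt-updates i z) (trans (updateAt-minimal J i z J≢i) zJ))

module _ {f : BoolFun (suc (suc n))} (pos : Positive f) (ns : NonSplit f) (i : Fin (suc (suc n))) where

  f₀-splits-by-zero : Split (restrict i false f) → ∃ λ j → IsZero (restrict j false (restrict i false f))
  f₀-splits-by-zero (j , inj₁ zero₀) = j , zero₀
  f₀-splits-by-zero (j , inj₂ one₀) = ⊥-elim (ns (punchIn i j , inj₂ (face⇒restrict (punchIn i j)
    (one-face-widen pos (punchInᵢ≢i i j) (restrict²⇒face i j (positive⇒extensional pos) one₀)))))

  f₁-splits-by-one : Split (restrict i true f) → ∃ λ k → IsOne (restrict k true (restrict i true f))
  f₁-splits-by-one (k , inj₂ one₁) = k , one₁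
  f₁-splits-by-one (k , inj₁ zero₁) = ⊥-elim (ns (punchIn i k , inj₁ (face⇒restrict (punchIn i k)
    (zero-face-widen pos (punchInᵢ≢i i k) (restrict²⇒face i k (positive⇒extensional pos) zero₁)))))

_↭₂_ : A × A → A × A → Set
(a , b) ↭₂ (c , d) = (a ≡ c × b ≡ d) ⊎ (a ≡ d × b ≡ c)

+-↭₂ : ∀ (g : A → ℚ) {a b c d} → (a , b) ↭₂ (c , d) → g a + g b ≡ g c + g d
+-↭₂ g (inj₁ (refl , refl)) = refl
+-↭₂ g (inj₂ (refl , refl)) = +-comm (g _) (g _)

weightedSum-↭₂ : ∀ (w : Fin n → ℚ) {p r q s : Fin n → Bool} → (∀ l → (p l , r l) ↭₂ (q l , s l)) →
  weightedSum w p + weightedSum w r ≡ weightedSum w q + weightedSum w s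
weightedSum-↭₂ {n = zero} w perm = refl
weightedSum-↭₂ {n = suc n} w {p} {r} {q} {s} perm = begin
  (x₀ p + xs p) + (x₀ r + xs r)  ≡⟨ interchange (x₀ p) (xs p) (x₀ r) (xs r) ⟩
  (x₀ p + x₀ r) + (xs p + xs r)  ≡⟨ cong₂ _+_ (+-↭₂ term (perm zero)) (weightedSum-↭₂ (w ∘ suc) (perm ∘ suc)) ⟩
  (x₀ q + x₀ s) + (xs q + xs s)  ≡⟨ interchange (x₀ q) (x₀ s) (xs q) (xs s) ⟩
  (x₀ q + xs q) + (x₀ s + xs s)  ∎
  where
  open ≡-Reasoning
  term : Bool → ℚ
  term b = if b then w zero else 0ℚ
  x₀ xs : (Fin (suc n) → Bool) → ℚ
  x₀ x = term (x zero)
  xs x = weightedSum (w ∘ suc) (x ∘ suc)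

threshold-asummable : {f : BoolFun n} → Threshold f → ∀ {p r q s} →
  f p ≡ true → f r ≡ true → f q ≡ false → f s ≡ false → ¬ (∀ l → (p l , r l) ↭₂ (q l , s l))
threshold-asummable {f = f} (w , t , separates) fp fr fq fs perm =
  <-irrefl (sym (weightedSum-↭₂ w perm))
    (≤-<-trans (+-mono-≤ (below fq) (below fs)) (+-mono-< (above fp) (above fr)))
  where
  below : ∀ {x} → f x ≡ false → weightedSum w x ≤ t
  below = Equivalence.to (separates _)
  above : ∀ {x} → f x ≡ true → t < weightedSum w x
  above fx = ≰⇒> λ le → not-¬ fx (Equivalence.from (separates _) le)

module _ {f : BoolFun n} (th : Threshold f) {i J K : Fin n}
  (zero₀ : ∀ z → z i ≡ false → z J ≡ false → f z ≡ false)
  (one₁ : ∀ z → z i ≡ true → z K ≡ true → f z ≡ true) where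

  threshold-exchange : ∀ {p} → p i ≡ false → p K ≡ false → f p ≡ true →
    ∀ q → q i ≡ true → q J ≡ true → f q ≡ true
  threshold-exchange {p} pi pK fp q qi qJ with f q in fq
  ... | true  = refl
  ... | false = contradiction perm (threshold-asummable th fp fr fq fs)
    where
    pJ : p J ≡ true
    pJ = ¬-not (not-¬ fp ∘ zero₀ p pi)
    qK : q K ≡ false
    qK = ¬-not (not-¬ fq ∘ one₁ q qi)

    distinct : ∀ {x : Fin n → Bool} {a b} → x a ≡ true → x b ≡ false → a ≢ b
    distinct xa xb refl = not-¬ xa xb

    move : (Fin n → Bool) → Fin n → Bool
    move x = updateAt (updateAt x J (const false)) K (const true)

    move-K : ∀ x → move x K ≡ true
    move-K x = updateAt-updates K _
    move-J : ∀ x → move x J ≡ false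
    move-J x = trans (updateAt-minimal J K _ (distinct pJ pK)) (updateAt-updates J x)
    move-other : ∀ x {l} → l ≢ J → l ≢ K → move x l ≡ x l
    move-other x l≢J l≢K = trans (updateAt-minimal _ K _ l≢K) (updateAt-minimal _ J x l≢J)

    fr : f (move q) ≡ true
    fr = one₁ (move q) (trans (move-other q (≢-sym (distinct pJ pi)) (distinct qi qK)) qi) (move-K q)
    fs : f (move p) ≡ false
    fs = zero₀ (move p) (trans (move-other p (≢-sym (distinct pJ pi)) (distinct qi qK)) pi) (move-J p)

    perm : ∀ l → (p l , move q l) ↭₂ (q l , move p l)
    perm l with l ≟ J | l ≟ K
    ... | yes refl | _        = inj₁ (trans pJ (sym qJ) , trans (move-J q) (sym (move-J p)))
    ... | no _     | yes refl = inj₁ (trans pK (sym qK) , trans (move-K q) (sym (move-K p)))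
    ... | no l≢J   | no l≢K   = inj₂ (sym (move-other p l≢J l≢K) , move-other q l≢J l≢K)

claim2 : ∀ {m : ℕ} (f : BoolFun (suc m)) → Positive f → Threshold f → NonSplit f →
    (i : Fin (suc m)) →
    Split (restrict i false f) → Split (restrict i true f) →
    CommonSplitVar (restrict i false f) (restrict i true f)
claim2 {zero} f pos th ns i () _
claim2 {suc m} f pos th ns i split₀ split₁
  with f₀-splits-by-zero pos ns i split₀ | f₁-splits-by-one pos ns i split₁
... | j , zero₀ | k , one₁
  with isZero⊎true (restrict-extensional (restrict-extensional (positive⇒extensional pos) i false) k false)
...   | inj₁ zero₀ᵏ = k , zero₀ᵏ , one₁
...   | inj₂ (y , fp) = j , zero₀ , face⇒restrict² i j
  (threshold-exchange th (restrict²⇒face i j ext zero₀) (restrict²⇒face i k ext one₁)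
    (insertAt-lookup _ i false) (insertAt²-punchIn y i k) fp)
  where
  ext : Extensional f
  ext = positive⇒extensional pos
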